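{- Let $N \ge 1$ and let $A_1,\dots,A_N$ be distinct boolean variables. Define $C_N = A_N$ and, for $k=N-1,\dots,1$, $C_k = ((A_k<1) < C_{k+1})$. Then the conjunction $A_1\wedge A_2\wedge\dots\wedge A_N$ has a minimal $(<,1)$-representation with exactly $N-1$ occurrences of the constant $1$ and exactly one occurrence of each input variable, given by $$A_1\wedge A_2\wedge\dots\wedge A_N = C_1 = ((A_1<1) < ((A_2<1) < \dots ((A_{N-1}<1) < A_N)\dots)).$$ Here minimal means that no $(<,1)$-expression computing $A_1\wedge\dots\wedge A_N$ uses fewer occurrences of the operation $<$.
   Context: Strict Boolean Inequality is the binary boolean operation with $A<B=1$ iff $A=0$ and $B=1$. A $(<,1)$-representation (or $(<,1)$-expression) of a boolean function is an expression built from input variables and the constant $1$ using only the binary operation $<$ (variables and constants may occur several times); its cost is the number of occurrences of $<$ (the constant $1$ has zero cost). -}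

module Defs where

open import Data.Nat using (ℕ; zero; suc; _+_)
open import Data.Fin using (Fin; zero; suc)
open import Data.Bool using (Bool; true; false; _∧_; not)
open import Relation.Binary.PropositionalEquality using (_≡_)
open import Relation.Nullary using (yes; no)
open import Data.Fin using (_≟_)

_<ᵇ_ : Bool → Bool → Bool
a <ᵇ b = not a ∧ b

data Expr (n : ℕ) : Set where
  var : Fin n → Expr n
  one : Expr n
  _⟨<⟩_ : Expr n → Expr n → Expr n

eval : ∀ {n} → Expr n → (Fin n → Bool) → Bool
eval (var i) ρ = ρ i
eval one ρ = true
eval (e ⟨<⟩ f) ρ = eval e ρ <ᵇ eval f ρ

cost : ∀ {n} → Expr n → ℕ
cost (var i) = 0
cost one = 0
cost (e ⟨<⟩ f) = suc (cost e + cost f)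

ones : ∀ {n} → Expr n → ℕ
ones (var i) = 0
ones one = 1
ones (e ⟨<⟩ f) = ones e + ones f

occ : ∀ {n} → Fin n → Expr n → ℕ
occ i (var j) with i ≟ j
... | yes _ = 1
... | no _ = 0
occ i one = 0
occ i (e ⟨<⟩ f) = occ i e + occ i f

rename : ∀ {n m} → (Fin n → Fin m) → Expr n → Expr m
rename σ (var i) = var (σ i)
rename σ one = one
rename σ (e ⟨<⟩ f) = rename σ e ⟨<⟩ rename σ f

conj : ∀ {n} → (Fin n → Bool) → Bool
conj {zero} ρ = true
conj {suc n} ρ = ρ zero ∧ conj (λ i → ρ (suc i))

-- The expression C_1 over N = suc m variables (A_k is var of index k-1):
-- C_N = A_N,  C_k = ((A_k < 1) < C_{k+1}).
chain : (m : ℕ) → Expr (suc m)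
chain zero = var zero
chain (suc m) = (var zero ⟨<⟩ one) ⟨<⟩ rename suc (chain m)

Computes-conj : ∀ {n} → Expr n → Set
Computes-conj {n} e = (ρ : Fin n → Bool) → eval e ρ ≡ conj ρ

-- A single input change flips x <ᵇ y only if it flips an operand, and when the operands
-- evaluate to (true, true) or to (_, false) only one of them can matter. Hence the
-- sensitivity s(e) of an expression e at the all-true point 1 (the number of inputs whose
-- flip changes the value of e there) satisfies 2 s(e) ≤ cost e + 1 + [e(1) = true], by
-- induction on e. The conjunction of N inputs has sensitivity N and value true at that
-- point, so every expression computing it costs at least 2N - 2, which the chain attains.
module Submission where

open import Defs
open import Data.Bool using (Bool; true; false; not; _∧_; _xor_)
open import Data.Bool.Properties using (∧-identityʳ; ∧-zeroʳ; not-involutive)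
open import Data.Fin using (Fin; zero; suc; _≟_)
open import Data.Fin.Properties using (suc-injective)
open import Data.Nat using (ℕ; zero; suc; _+_; _*_; _≤_; z≤n; s≤s)
open import Data.Nat.Properties
  using (≤-trans; ≤-reflexive; +-mono-≤; *-monoʳ-≤; m≤m+n; m≤n+m; +-cancelʳ-≤;
         +-assoc; +-comm; *-suc; *-distribˡ-+; +-0-commutativeMonoid; module ≤-Reasoning)
open import Algebra.Properties.CommutativeMonoid.Sum +-0-commutativeMonoid
  using (sum; ∑-distrib-+; sum-cong-≗; sum-replicate-zero)
open import Data.Nat.Tactic.RingSolver using (solve)
open import Data.List using (_∷_; [])
open import Data.Product using (_×_; _,_)
open import Function using (_∘_)
open import Function.Definitions using (Injective)
open import Relation.Binary.PropositionalEquality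
  using (_≡_; _≢_; refl; sym; trans; cong; cong₂; subst; module ≡-Reasoning)
open import Relation.Nullary using (yes; no; contradiction)

private
  variable
    n : ℕ

toℕ : Bool → ℕ
toℕ false = 0
toℕ true  = 1

<ᵇ-true : ∀ x → x <ᵇ true ≡ not x
<ᵇ-true x = ∧-identityʳ (not x)

[x<ᵇtrue]<ᵇy≡x∧y : ∀ x y → (x <ᵇ true) <ᵇ y ≡ x ∧ y
[x<ᵇtrue]<ᵇy≡x∧y x y = cong (_∧ y) (trans (cong not (<ᵇ-true x)) (not-involutive x))

sum-mono-≤ : (f g : Fin n → ℕ) → (∀ i → f i ≤ g i) → sum f ≤ sum g
sum-mono-≤ {zero}  f g f≤g = z≤n
sum-mono-≤ {suc n} f g f≤g = +-mono-≤ (f≤g zero) (sum-mono-≤ (f ∘ suc) (g ∘ suc) (f≤g ∘ suc))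

sum-const-1 : ∀ n → sum {n} (λ _ → 1) ≡ n
sum-const-1 zero    = refl
sum-const-1 (suc n) = cong suc (sum-const-1 n)

eval-rename : ∀ {k} (σ : Fin n → Fin k) (e : Expr n) ρ → eval (rename σ e) ρ ≡ eval e (ρ ∘ σ)
eval-rename σ (var i)   ρ = refl
eval-rename σ one       ρ = refl
eval-rename σ (e ⟨<⟩ f) ρ = cong₂ _<ᵇ_ (eval-rename σ e ρ) (eval-rename σ f ρ)

cost-rename : ∀ {k} (σ : Fin n → Fin k) (e : Expr n) → cost (rename σ e) ≡ cost e
cost-rename σ (var i)   = refl
cost-rename σ one       = refl
cost-rename σ (e ⟨<⟩ f) = cong suc (cong₂ _+_ (cost-rename σ e) (cost-rename σ f))

ones-rename : ∀ {k} (σ : Fin n → Fin k) (e : Expr n) → ones (rename σ e) ≡ ones e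
ones-rename σ (var i)   = refl
ones-rename σ one       = refl
ones-rename σ (e ⟨<⟩ f) = cong₂ _+_ (ones-rename σ e) (ones-rename σ f)

occ-rename-injective : ∀ {k} {σ : Fin n → Fin k} → Injective _≡_ _≡_ σ →
                       ∀ i (e : Expr n) → occ (σ i) (rename σ e) ≡ occ i e
occ-rename-injective {σ = σ} σ-inj i (var j) with σ i ≟ σ j | i ≟ j
... | yes _       | yes _   = refl
... | no  _       | no  _   = refl
... | yes σi≡σj   | no  i≢j = contradiction (σ-inj σi≡σj) i≢j
... | no  σi≢σj   | yes i≡j = contradiction (cong σ i≡j) σi≢σj
occ-rename-injective σ-inj i one       = refl
occ-rename-injective σ-inj i (e ⟨<⟩ f) =
  cong₂ _+_ (occ-rename-injective σ-inj i e) (occ-rename-injective σ-inj i f)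

occ-rename-∉ : ∀ {k} {σ : Fin n → Fin k} {i} → (∀ j → σ j ≢ i) →
               (e : Expr n) → occ i (rename σ e) ≡ 0
occ-rename-∉ {σ = σ} {i} i∉σ (var j) with i ≟ σ j
... | yes i≡σj = contradiction (sym i≡σj) (i∉σ j)
... | no  _    = refl
occ-rename-∉ i∉σ one       = refl
occ-rename-∉ i∉σ (e ⟨<⟩ f) = cong₂ _+_ (occ-rename-∉ i∉σ e) (occ-rename-∉ i∉σ f)

chain-computes-conj : ∀ m → Computes-conj (chain m)
chain-computes-conj zero    ρ = sym (∧-identityʳ (ρ zero))
chain-computes-conj (suc m) ρ = begin
  (ρ zero <ᵇ true) <ᵇ eval (rename suc (chain m)) ρ ≡⟨ [x<ᵇtrue]<ᵇy≡x∧y (ρ zero) _ ⟩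
  ρ zero ∧ eval (rename suc (chain m)) ρ           ≡⟨ cong (ρ zero ∧_) (eval-rename suc (chain m) ρ) ⟩
  ρ zero ∧ eval (chain m) (ρ ∘ suc)                ≡⟨ cong (ρ zero ∧_) (chain-computes-conj m (ρ ∘ suc)) ⟩
  conj ρ                                           ∎
  where open ≡-Reasoning

ones-chain : ∀ m → ones (chain m) ≡ m
ones-chain zero    = refl
ones-chain (suc m) = cong suc (trans (ones-rename suc (chain m)) (ones-chain m))

occ-chain : ∀ m (i : Fin (suc m)) → occ i (chain m) ≡ 1
occ-chain zero    zero    = refl
occ-chain (suc m) zero    = cong suc (occ-rename-∉ (λ j ()) (chain m))
occ-chain (suc m) (suc i) = trans (occ-rename-injective suc-injective i (chain m)) (occ-chain m i)

cost-chain : ∀ m → cost (chain m) ≡ 2 * m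
cost-chain zero    = refl
cost-chain (suc m) = begin
  suc (suc (cost (rename suc (chain m)))) ≡⟨ cong (2 +_) (cost-rename suc (chain m)) ⟩
  suc (suc (cost (chain m)))              ≡⟨ cong (2 +_) (cost-chain m) ⟩
  2 + 2 * m                               ≡⟨ sym (*-suc 2 m) ⟩
  2 * suc m                               ∎
  where open ≡-Reasoning

all-true : Fin n → Bool
all-true _ = true

allTrueExcept : Fin n → Fin n → Bool
allTrueExcept zero    zero    = false
allTrueExcept zero    (suc j) = true
allTrueExcept (suc i) zero    = true
allTrueExcept (suc i) (suc j) = allTrueExcept i j

conj-all-true : conj (all-true {n}) ≡ true
conj-all-true {zero}  = refl
conj-all-true {suc n} = conj-all-true {n}

conj-allTrueExcept : (i : Fin n) → conj (allTrueExcept i) ≡ false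
conj-allTrueExcept zero    = refl
conj-allTrueExcept (suc i) = conj-allTrueExcept i

sum-flips-allTrueExcept : (i : Fin n) → sum (λ j → toℕ (not (allTrueExcept j i))) ≡ 1
sum-flips-allTrueExcept {suc n} zero    = cong suc (sum-replicate-zero n)
sum-flips-allTrueExcept         (suc i) = sum-flips-allTrueExcept i

sensitiveTo : Expr n → Fin n → ℕ
sensitiveTo e i = toℕ (eval e all-true xor eval e (allTrueExcept i))

sensitivity : Expr n → ℕ
sensitivity e = sum (sensitiveTo e)

-- Given p changes of x and q changes of y, this bounds the changes of x <ᵇ y:
-- at x = y = true the value false can only move through x, and at y = false only through y.
changes-<ᵇ : Bool → Bool → ℕ → ℕ → ℕ
changes-<ᵇ _     false p q = q
changes-<ᵇ false true  p q = p + q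
changes-<ᵇ true  true  p q = p

xor-<ᵇ : ∀ x y x′ y′ → toℕ ((x <ᵇ y) xor (x′ <ᵇ y′)) ≤ changes-<ᵇ x y (toℕ (x xor x′)) (toℕ (y xor y′))
xor-<ᵇ false false false false = z≤n
xor-<ᵇ false false false true  = s≤s z≤n
xor-<ᵇ false false true  false = z≤n
xor-<ᵇ false false true  true  = z≤n
xor-<ᵇ false true  false false = s≤s z≤n
xor-<ᵇ false true  false true  = z≤n
xor-<ᵇ false true  true  false = s≤s z≤n
xor-<ᵇ false true  true  true  = s≤s z≤n
xor-<ᵇ true  false false false = z≤n
xor-<ᵇ true  false false true  = s≤s z≤n
xor-<ᵇ true  false true  false = z≤n
xor-<ᵇ true  false true  true  = z≤n
xor-<ᵇ true  true  false false = z≤n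
xor-<ᵇ true  true  false true  = s≤s z≤n
xor-<ᵇ true  true  true  false = z≤n
xor-<ᵇ true  true  true  true  = z≤n

sum-changes-<ᵇ : ∀ x y (p q : Fin n → ℕ) →
                 sum (λ i → changes-<ᵇ x y (p i) (q i)) ≡ changes-<ᵇ x y (sum p) (sum q)
sum-changes-<ᵇ _     false p q = refl
sum-changes-<ᵇ false true  p q = ∑-distrib-+ p q
sum-changes-<ᵇ true  true  p q = refl

sensitivity-⟨<⟩ : (f g : Expr n) →
  sensitivity (f ⟨<⟩ g) ≤ changes-<ᵇ (eval f all-true) (eval g all-true) (sensitivity f) (sensitivity g)
sensitivity-⟨<⟩ f g = ≤-trans
  (sum-mono-≤ _ _ (λ i → xor-<ᵇ x y (eval f (allTrueExcept i)) (eval g (allTrueExcept i))))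
  (≤-reflexive (sum-changes-<ᵇ x y (sensitiveTo f) (sensitiveTo g)))
  where
  x = eval f all-true
  y = eval g all-true

sensitivity-bound-⟨<⟩ : ∀ x y {s sf sg cf cg} → s ≤ changes-<ᵇ x y sf sg →
  2 * sf ≤ cf + 1 + toℕ x → 2 * sg ≤ cg + 1 + toℕ y → 2 * s ≤ suc (cf + cg) + 1 + toℕ (x <ᵇ y)
sensitivity-bound-⟨<⟩ x false {s = s} {sg = sg} {cf} {cg} s≤ _ bg =
  subst (λ v → 2 * s ≤ suc (cf + cg) + 1 + toℕ v) (sym (∧-zeroʳ (not x))) (begin
    2 * s                    ≤⟨ *-monoʳ-≤ 2 s≤ ⟩
    2 * sg                   ≤⟨ bg ⟩
    cg + 1 + 0               ≤⟨ m≤n+m _ (suc cf) ⟩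
    suc cf + (cg + 1 + 0)    ≡⟨ solve (cf ∷ cg ∷ []) ⟩
    suc (cf + cg) + 1 + 0    ∎)
  where open ≤-Reasoning
sensitivity-bound-⟨<⟩ false true {s} {sf} {sg} {cf} {cg} s≤ bf bg = begin
  2 * s                          ≤⟨ *-monoʳ-≤ 2 s≤ ⟩
  2 * (sf + sg)                  ≡⟨ *-distribˡ-+ 2 sf sg ⟩
  2 * sf + 2 * sg                ≤⟨ +-mono-≤ bf bg ⟩
  (cf + 1 + 0) + (cg + 1 + 1)    ≡⟨ solve (cf ∷ cg ∷ []) ⟩
  suc (cf + cg) + 1 + 1          ∎
  where open ≤-Reasoning
sensitivity-bound-⟨<⟩ true true {s} {sf} {cf = cf} {cg} s≤ bf _ = begin
  2 * s                    ≤⟨ *-monoʳ-≤ 2 s≤ ⟩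
  2 * sf                   ≤⟨ bf ⟩
  cf + 1 + 1               ≤⟨ m≤m+n _ cg ⟩
  cf + 1 + 1 + cg          ≡⟨ solve (cf ∷ cg ∷ []) ⟩
  suc (cf + cg) + 1 + 0    ∎
  where open ≤-Reasoning

sensitivity-bound : (e : Expr n) → 2 * sensitivity e ≤ cost e + 1 + toℕ (eval e all-true)
sensitivity-bound     (var i)   = ≤-reflexive (cong (2 *_) (sum-flips-allTrueExcept i))
sensitivity-bound {n} one       = ≤-trans (≤-reflexive (cong (2 *_) (sum-replicate-zero n))) z≤n
sensitivity-bound     (f ⟨<⟩ g) = sensitivity-bound-⟨<⟩ (eval f all-true) (eval g all-true)
  (sensitivity-⟨<⟩ f g) (sensitivity-bound f) (sensitivity-bound g)

conj-at-all-true : (e : Expr n) → Computes-conj e → eval e all-true ≡ true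
conj-at-all-true {n} e computes = trans (computes all-true) (conj-all-true {n})

sensitivity-conj : (e : Expr n) → Computes-conj e → sensitivity e ≡ n
sensitivity-conj {n} e computes = trans (sum-cong-≗ flips) (sum-const-1 n)
  where
  flips : ∀ i → sensitiveTo e i ≡ 1
  flips i = cong₂ (λ a b → toℕ (a xor b))
    (conj-at-all-true e computes)
    (trans (computes (allTrueExcept i)) (conj-allTrueExcept i))

conj-cost-lower-bound : (e : Expr n) → Computes-conj e → 2 * n ≤ cost e + 2
conj-cost-lower-bound {n} e computes = begin
  2 * n                                  ≡⟨ cong (2 *_) (sensitivity-conj e computes) ⟨
  2 * sensitivity e                      ≤⟨ sensitivity-bound e ⟩
  cost e + 1 + toℕ (eval e all-true)     ≡⟨ cong (λ v → cost e + 1 + toℕ v) (conj-at-all-true e computes) ⟩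
  cost e + 1 + 1                         ≡⟨ +-assoc (cost e) 1 1 ⟩
  cost e + 2                             ∎
  where open ≤-Reasoning

chain-minimal : ∀ m (e : Expr (suc m)) → Computes-conj e → cost (chain m) ≤ cost e
chain-minimal m e computes = begin
  cost (chain m) ≡⟨ cost-chain m ⟩
  2 * m          ≤⟨ +-cancelʳ-≤ 2 (2 * m) (cost e) 2*m+2≤cost+2 ⟩
  cost e         ∎
  where
  open ≤-Reasoning
  2*m+2≤cost+2 : 2 * m + 2 ≤ cost e + 2
  2*m+2≤cost+2 = subst (_≤ cost e + 2) (trans (*-suc 2 m) (+-comm 2 (2 * m)))
                       (conj-cost-lower-bound e computes)

proposition5 : (m : ℕ)
    → Computes-conj (chain m)
    × ones (chain m) ≡ m
    × ((i : Fin (suc m)) → occ i (chain m) ≡ 1)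
    × ((e : Expr (suc m)) → Computes-conj e → cost (chain m) ≤ cost e)
proposition5 m = chain-computes-conj m , ones-chain m , occ-chain m , chain-minimal m
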